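{- Let $n = 2^{\alpha-1}p^3$, where $\alpha>1$ is an integer and $p$ is an odd prime with $p\equiv 3 \pmod 4$ and $p<3\cdot 2^{\alpha-1}-1$. Then $n$ does not divide $\sigma_5(n)$.
   Context: For a positive integer $n$ and integer $k\ge 1$, $\sigma_k(n)=\sum_{d\mid n} d^k$, the sum over positive divisors $d$ of $n$. -}

module Defs where

open import Data.Nat using (ℕ; zero; suc; _+_; _^_)
open import Data.Nat.Divisibility using (_∣_; _∣?_)
open import Data.List using (List; map; filter)
open import Data.Nat.ListAction using (sum)
open import Data.List.Base using (upTo)

divisors : ℕ → List ℕ
divisors n = filter (_∣? n) (map suc (upTo n))

σ : ℕ → ℕ → ℕ
σ k n = sum (map (λ d → d ^ k) (divisors n))

-- Write n = 2^a p^3 with a = α - 1. Multiplicativity gives σ₅(n) = G·Q with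
-- G = 1 + 32 + ... + 32^a (odd) and Q = 1 + p^5 + p^10 + p^15 (prime to p), so n ∣ σ₅(n)
-- forces 2^a ∣ Q and p^3 ∣ G. Since Q = (1 + p^5)(1 + p^10) = 2(1 + p)·odd for odd p, we
-- get 1 + p = k·2^(a-1), and the bound on p gives k < 6. Now 31G + 1 = 32^(a+1), so
-- k^5 (31G + 1) = 1024 (1 + p)^5; reducing mod p gives p ∣ |k^5 - 1024|. For k = 4 we reduce
-- mod p^3 instead and get p ∣ 5, impossible for p ≡ 3 (mod 4); for k ∈ {1, 2, 3, 5} the
-- divisibility bounds p, hence a, and the finitely many remaining cases are checked.
module Submission where

open import Data.List using (List; []; _∷_; _++_; map; upTo)
open import Data.List.Membership.Propositional using (_∈_)
open import Data.List.Membership.Propositional.Properties using (∈-map⁺; ∈-map⁻; ∈-++⁺ˡ; ∈-++⁺ʳ; ∈-++⁻; ∈-filter⁺; ∈-filter⁻; ∈-upTo⁺)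
open import Data.List.Membership.Propositional.Properties.WithK using (unique∧set⇒bag)
open import Data.List.Properties using (map-++)
open import Data.List.Relation.Binary.BagAndSetEquality using (∼bag⇒↭)
open import Data.List.Relation.Binary.Permutation.Propositional using (_↭_)
import Data.List.Relation.Binary.Permutation.Propositional.Properties as ↭
open import Data.List.Relation.Unary.All as All using (All)
open import Data.List.Relation.Unary.AllPairs using (_∷_; [])
open import Data.List.Relation.Unary.Any using (here; there)
open import Data.List.Relation.Unary.Unique.Propositional using (Unique)
import Data.List.Relation.Unary.Unique.Propositional.Properties as Unique
open import Data.Nat
open import Data.Nat.Coprimality using (Coprime; coprime-divisor)
open import Data.Nat.Divisibility
open import Data.Nat.DivMod using (m≡m%n+[m/n]*n)
open import Data.Nat.ListAction using (sum)
open import Data.Nat.ListAction.Properties using (sum-++; sum-↭)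
open import Data.Nat.Primality using (Prime; prime?; prime[2]; prime⇒irreducible; prime⇒nonZero; prime⇒nonTrivial; euclidsLemma)
open import Data.Nat.Properties
open import Data.Nat.Solver using (module +-*-Solver)
open import Data.Nat.Tactic.RingSolver using (solve-∀)
open import Data.Empty using (⊥)
open import Data.Product using (_×_; _,_; proj₁; proj₂; ∃; ∃₂)
open import Data.Sum using (inj₁; inj₂)
open import Defs
open import Function.Bundles using (mk⇔)
open import Relation.Nullary using (¬_; Dec; yes; no; ¬?; contradiction)
open import Relation.Nullary.Decidable using (from-yes; _×-dec_)
open import Relation.Binary.PropositionalEquality
open import Algebra.Properties.CommutativeSemigroup *-commutativeSemigroup using (interchange; x∙yz≈y∙xz)

open +-*-Solver using (solve; _:+_; _:*_; _:^_; _:=_; con)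

prime≢1 : ∀ {p} → Prime p → p ≢ 1
prime≢1 p-prime = nonTrivial⇒≢1 {{prime⇒nonTrivial p-prime}}

prime∤⇒coprime : ∀ {q m} → Prime q → q ∤ m → Coprime m q
prime∤⇒coprime q-prime q∤m (d∣m , d∣q) with prime⇒irreducible q-prime d∣q
... | inj₁ d≡1 = d≡1
... | inj₂ refl = contradiction d∣m q∤m

coprime-^-divisor : ∀ {m n} o s → Coprime m n → m ∣ n ^ s * o → m ∣ o
coprime-^-divisor {m} o zero _ m∣o = subst (m ∣_) (*-identityˡ o) m∣o
coprime-^-divisor {m} {n} o (suc s) m⊥n m∣ =
  coprime-^-divisor o s m⊥n (coprime-divisor m⊥n (subst (m ∣_) (*-assoc n (n ^ s) o) m∣))

prime∣m^n⇒∣m : ∀ {q} m n → Prime q → q ∣ m ^ n → q ∣ m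
prime∣m^n⇒∣m m zero q-prime q∣1 = contradiction (∣1⇒≡1 q∣1) (prime≢1 q-prime)
prime∣m^n⇒∣m m (suc n) q-prime q∣m*m^n with euclidsLemma m (m ^ n) q-prime q∣m*m^n
... | inj₁ q∣m = q∣m
... | inj₂ q∣m^n = prime∣m^n⇒∣m m n q-prime q∣m^n

prime^∣m*n⇒∣m : ∀ {q n} c m → Prime q → q ∤ n → q ^ c ∣ m * n → q ^ c ∣ m
prime^∣m*n⇒∣m zero m _ _ _ = 1∣ m
prime^∣m*n⇒∣m {q} {n} (suc c) m q-prime q∤n q^c+1∣
  with euclidsLemma m n q-prime (∣-trans (m∣m*n (q ^ c)) q^c+1∣)
... | inj₂ q∣n = contradiction q∣n q∤n
... | inj₁ (divides m′ refl) =
  subst (q ^ suc c ∣_) (*-comm q m′) (*-monoʳ-∣ q (prime^∣m*n⇒∣m c m′ q-prime q∤n q^c∣m′*n))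
  where
  instance _ = prime⇒nonZero q-prime
  rearrange : ∀ a b c → a * b * c ≡ b * (a * c)
  rearrange = solve-∀
  q^c∣m′*n : q ^ c ∣ m′ * n
  q^c∣m′*n = *-cancelˡ-∣ q (subst (q ^ suc c ∣_) (rearrange m′ q n) q^c+1∣)

∣m⇒∤1+m*n : ∀ {d} m n → d ≢ 1 → d ∣ m → d ∤ 1 + m * n
∣m⇒∤1+m*n {d} m n d≢1 d∣m d∣1+mn =
  d≢1 (∣1⇒≡1 (∣m+n∣m⇒∣n (subst (d ∣_) (+-comm 1 (m * n)) d∣1+mn) (∣m⇒∣m*n n d∣m)))

m+d*x≡n+d*y⇒d∣n∸m : ∀ {d m n} x y → m ≤ n → m + d * x ≡ n + d * y → d ∣ n ∸ m
m+d*x≡n+d*y⇒d∣n∸m {d} {m} {n} x y m≤n eq = ∣m+n∣m⇒∣n (subst (d ∣_) dx≡ (m∣m*n x)) (m∣m*n y)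
  where
  open ≡-Reasoning
  dx≡ : d * x ≡ d * y + (n ∸ m)
  dx≡ = +-cancelˡ-≡ m _ _ (begin
    m + d * x             ≡⟨ eq ⟩
    n + d * y             ≡⟨ cong (_+ d * y) (m+[n∸m]≡n m≤n) ⟨
    m + (n ∸ m) + d * y   ≡⟨ +-assoc m (n ∸ m) (d * y) ⟩
    m + (n ∸ m + d * y)   ≡⟨ cong (m +_) (+-comm (n ∸ m) (d * y)) ⟩
    m + (d * y + (n ∸ m)) ∎)

m+d*x≡n+d*y⇒d∣∣m-n∣ : ∀ {d} m n x y → m + d * x ≡ n + d * y → d ∣ ∣ m - n ∣
m+d*x≡n+d*y⇒d∣∣m-n∣ {d} m n x y eq with ≤-total m n
... | inj₁ m≤n = subst (d ∣_) (sym (m≤n⇒∣m-n∣≡n∸m m≤n)) (m+d*x≡n+d*y⇒d∣n∸m x y m≤n eq)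
... | inj₂ n≤m = subst (d ∣_) (sym (m≤n⇒∣n-m∣≡n∸m n≤m)) (m+d*x≡n+d*y⇒d∣n∸m y x n≤m (sym eq))

^-distribʳ-* : ∀ m n k → (m * n) ^ k ≡ m ^ k * n ^ k
^-distribʳ-* m n zero = refl
^-distribʳ-* m n (suc k) = trans (cong (m * n *_) (^-distribʳ-* m n k)) (interchange m n (m ^ k) (n ^ k))

[1+m*t]^n≡1+m*w : ∀ m t n → ∃ λ w → (1 + m * t) ^ n ≡ 1 + m * w
[1+m*t]^n≡1+m*w m t zero = 0 , cong suc (sym (*-zeroʳ m))
[1+m*t]^n≡1+m*w m t (suc n) =
  let w , eq = [1+m*t]^n≡1+m*w m t n in
  t + w + m * t * w , trans (cong ((1 + m * t) *_) eq) (expand m t w)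
  where
  expand : ∀ m t w → (1 + m * t) * (1 + m * w) ≡ 1 + m * (t + w + m * t * w)
  expand = solve-∀

m<n∸1⇒1+m<n : ∀ {m} n → m < n ∸ 1 → 1 + m < n
m<n∸1⇒1+m<n (suc n) m<n = s≤s m<n

3mod4⇒odd : ∀ p → p % 4 ≡ 3 → p ≡ 1 + 2 * (1 + 2 * (p / 4))
3mod4⇒odd p p%4≡3 = trans (m≡m%n+[m/n]*n p 4) (trans (cong (_+ p / 4 * 4) p%4≡3) (regroup (p / 4)))
  where
  regroup : ∀ q → 3 + q * 4 ≡ 1 + 2 * (1 + 2 * q)
  regroup = solve-∀

3mod4∤5 : ∀ {p} → p % 4 ≡ 3 → p ∤ 5
3mod4∤5 p%4≡3 p∣5 with prime⇒irreducible (from-yes (prime? 5)) p∣5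
3mod4∤5 () _ | inj₁ refl
3mod4∤5 () _ | inj₂ refl

powerSum : ℕ → ℕ → ℕ
powerSum x zero = 1
powerSum x (suc i) = 1 + x * powerSum x i

powerSum-geometric : ∀ y i → y * powerSum (1 + y) i + 1 ≡ (1 + y) ^ suc i
powerSum-geometric y zero = +-comm (y * 1) 1
powerSum-geometric y (suc i) =
  trans (shift y (powerSum (1 + y) i)) (cong ((1 + y) *_) (powerSum-geometric y i))
  where
  shift : ∀ y s → y * (1 + (1 + y) * s) + 1 ≡ (1 + y) * (y * s + 1)
  shift = solve-∀

∤powerSum : ∀ {d x} i → d ≢ 1 → d ∣ x → d ∤ powerSum x i
∤powerSum zero d≢1 _ d∣1 = d≢1 (∣1⇒≡1 d∣1)
∤powerSum {x = x} (suc i) d≢1 d∣x = ∣m⇒∤1+m*n x (powerSum x i) d≢1 d∣x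

powers : ℕ → ℕ → List ℕ
powers q zero = 1 ∷ []
powers q (suc i) = 1 ∷ map (q *_) (powers q i)

powerProducts : ℕ → ℕ → ℕ → ℕ → List ℕ
powerProducts q a p zero = powers q a
powerProducts q a p (suc s) = powers q a ++ map (p *_) (powerProducts q a p s)

sum-^-map-* : ∀ k q xs → sum (map (_^ k) (map (q *_) xs)) ≡ q ^ k * sum (map (_^ k) xs)
sum-^-map-* k q [] = sym (*-zeroʳ (q ^ k))
sum-^-map-* k q (x ∷ xs) = begin
    (q * x) ^ k + sum (map (_^ k) (map (q *_) xs))
  ≡⟨ cong₂ _+_ (^-distribʳ-* q x k) (sum-^-map-* k q xs) ⟩
    q ^ k * x ^ k + q ^ k * sum (map (_^ k) xs)
  ≡⟨ *-distribˡ-+ (q ^ k) (x ^ k) _ ⟨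
    q ^ k * (x ^ k + sum (map (_^ k) xs)) ∎
  where open ≡-Reasoning

sum-^-powers : ∀ k q i → sum (map (_^ k) (powers q i)) ≡ powerSum (q ^ k) i
sum-^-powers k q zero = trans (+-identityʳ (1 ^ k)) (^-zeroˡ k)
sum-^-powers k q (suc i) =
  cong₂ _+_ (^-zeroˡ k) (trans (sum-^-map-* k q (powers q i)) (cong (q ^ k *_) (sum-^-powers k q i)))

sum-^-powerProducts : ∀ k q a p s →
  sum (map (_^ k) (powerProducts q a p s)) ≡ powerSum (q ^ k) a * powerSum (p ^ k) s
sum-^-powerProducts k q a p zero = trans (sum-^-powers k q a) (sym (*-identityʳ _))
sum-^-powerProducts k q a p (suc s) = begin
    sum (map (_^ k) (powers q a ++ map (p *_) (powerProducts q a p s)))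
  ≡⟨ cong sum (map-++ (_^ k) (powers q a) _) ⟩
    sum (map (_^ k) (powers q a) ++ map (_^ k) (map (p *_) (powerProducts q a p s)))
  ≡⟨ sum-++ (map (_^ k) (powers q a)) _ ⟩
    sum (map (_^ k) (powers q a)) + sum (map (_^ k) (map (p *_) (powerProducts q a p s)))
  ≡⟨ cong₂ _+_ (sum-^-powers k q a) (sum-^-map-* k p (powerProducts q a p s)) ⟩
    G + p ^ k * sum (map (_^ k) (powerProducts q a p s))
  ≡⟨ cong (λ z → G + p ^ k * z) (sum-^-powerProducts k q a p s) ⟩
    G + p ^ k * (G * powerSum (p ^ k) s)
  ≡⟨ factor G (p ^ k) (powerSum (p ^ k) s) ⟩
    G * powerSum (p ^ k) (suc s) ∎
  where
  open ≡-Reasoning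
  G : ℕ
  G = powerSum (q ^ k) a
  factor : ∀ g y z → g + y * (g * z) ≡ g * (1 + y * z)
  factor = solve-∀

∈-powers⇒∣ : ∀ q i {x} → x ∈ powers q i → x ∣ q ^ i
∈-powers⇒∣ q zero (here refl) = ∣-refl
∈-powers⇒∣ q (suc i) (here refl) = 1∣ _
∈-powers⇒∣ q (suc i) (there x∈) with ∈-map⁻ (q *_) x∈
... | y , y∈ , refl = *-monoʳ-∣ q (∈-powers⇒∣ q i y∈)

∣⇒∈-powers : ∀ {q} i {x} → Prime q → x ∣ q ^ i → x ∈ powers q i
∣⇒∈-powers zero _ x∣1 rewrite ∣1⇒≡1 x∣1 = here refl
∣⇒∈-powers {q} (suc i) {x} q-prime x∣ with q ∣? x
... | yes (divides y refl) =
  there (subst (_∈ map (q *_) (powers q i)) (*-comm q y) (∈-map⁺ (q *_) (∣⇒∈-powers i q-prime y∣q^i)))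
  where
  instance _ = prime⇒nonZero q-prime
  y∣q^i : y ∣ q ^ i
  y∣q^i = *-cancelˡ-∣ q (subst (_∣ q ^ suc i) (*-comm y q) x∣)
... | no q∤x with ∣1⇒≡1 (coprime-^-divisor 1 (suc i) (prime∤⇒coprime q-prime q∤x)
                            (subst (x ∣_) (sym (*-identityʳ _)) x∣))
... | refl = here refl

powers-unique : ∀ {q} i → Prime q → Unique (powers q i)
powers-unique zero _ = All.[] ∷ []
powers-unique {q} (suc i) q-prime =
  All.tabulate 1∉ ∷ Unique.map⁺ (*-cancelˡ-≡ _ _ q) (powers-unique i q-prime)
  where
  instance _ = prime⇒nonZero q-prime
  1∉ : ∀ {z} → z ∈ map (q *_) (powers q i) → 1 ≢ z
  1∉ z∈ 1≡z with ∈-map⁻ (q *_) z∈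
  ... | y , _ , refl = prime≢1 q-prime (∣1⇒≡1 (subst (q ∣_) (sym 1≡z) (m∣m*n y)))

∈-powerProducts⇒∣ : ∀ q a p s {x} → x ∈ powerProducts q a p s → x ∣ q ^ a * p ^ s
∈-powerProducts⇒∣ q a p zero x∈ = ∣m⇒∣m*n 1 (∈-powers⇒∣ q a x∈)
∈-powerProducts⇒∣ q a p (suc s) x∈ with ∈-++⁻ (powers q a) x∈
... | inj₁ x∈powers = ∣m⇒∣m*n (p ^ suc s) (∈-powers⇒∣ q a x∈powers)
... | inj₂ x∈map with ∈-map⁻ (p *_) x∈map
... | y , y∈ , refl =
  subst (p * y ∣_) (x∙yz≈y∙xz p (q ^ a) (p ^ s)) (*-monoʳ-∣ p (∈-powerProducts⇒∣ q a p s y∈))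

∣⇒∈-powerProducts : ∀ {q p} a s {x} → Prime q → Prime p →
  x ∣ q ^ a * p ^ s → x ∈ powerProducts q a p s
∣⇒∈-powerProducts a zero {x} q-prime _ x∣ = ∣⇒∈-powers a q-prime (subst (x ∣_) (*-identityʳ _) x∣)
∣⇒∈-powerProducts {q} {p} a (suc s) {x} q-prime p-prime x∣ with p ∣? x
... | yes (divides y refl) =
  ∈-++⁺ʳ (powers q a) (subst (_∈ map (p *_) (powerProducts q a p s)) (*-comm p y)
    (∈-map⁺ (p *_) (∣⇒∈-powerProducts a s q-prime p-prime y∣)))
  where
  instance _ = prime⇒nonZero p-prime
  y∣ : y ∣ q ^ a * p ^ s
  y∣ = *-cancelˡ-∣ p (subst₂ _∣_ (*-comm y p) (x∙yz≈y∙xz (q ^ a) p (p ^ s)) x∣)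
... | no p∤x = ∈-++⁺ˡ (∣⇒∈-powers a q-prime
  (coprime-^-divisor (q ^ a) (suc s) (prime∤⇒coprime p-prime p∤x) (subst (x ∣_) (*-comm (q ^ a) _) x∣)))

powerProducts-unique : ∀ {q p} a s → Prime q → Prime p → p ≢ q → Unique (powerProducts q a p s)
powerProducts-unique a zero q-prime _ _ = powers-unique a q-prime
powerProducts-unique {q} {p} a (suc s) q-prime p-prime p≢q =
  Unique.++⁺ (powers-unique a q-prime)
    (Unique.map⁺ (*-cancelˡ-≡ _ _ p) (powerProducts-unique a s q-prime p-prime p≢q)) disjoint
  where
  instance _ = prime⇒nonZero p-prime
  disjoint : ∀ {v} → ¬ (v ∈ powers q a × v ∈ map (p *_) (powerProducts q a p s))
  disjoint (v∈powers , v∈map) with ∈-map⁻ (p *_) v∈map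
  ... | y , _ , refl with prime⇒irreducible q-prime
        (prime∣m^n⇒∣m q a p-prime (∣-trans (m∣m*n y) (∈-powers⇒∣ q a v∈powers)))
  ... | inj₁ p≡1 = prime≢1 p-prime p≡1
  ... | inj₂ p≡q = p≢q p≡q

∈-divisors⁺ : ∀ {n d} .{{_ : NonZero n}} → d ∣ n → d ∈ divisors n
∈-divisors⁺ {n} {zero} 0∣n = contradiction (0∣⇒≡0 0∣n) (≢-nonZero⁻¹ n)
∈-divisors⁺ {n} {suc d} d∣n = ∈-filter⁺ (_∣? n) (∈-map⁺ suc (∈-upTo⁺ (∣⇒≤ d∣n))) d∣n

∈-divisors⁻ : ∀ {n d} → d ∈ divisors n → d ∣ n
∈-divisors⁻ {n} d∈ with ∈-filter⁻ (_∣? n) {xs = map suc (upTo n)} d∈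
... | _ , d∣n = d∣n

divisors-unique : ∀ n → Unique (divisors n)
divisors-unique n = Unique.filter⁺ (_∣? n) (Unique.map⁺ suc-injective (Unique.upTo⁺ n))

divisors↭powerProducts : ∀ {q p} a s → Prime q → Prime p → p ≢ q →
  divisors (q ^ a * p ^ s) ↭ powerProducts q a p s
divisors↭powerProducts {q} {p} a s q-prime p-prime p≢q =
  ∼bag⇒↭ (unique∧set⇒bag (divisors-unique (q ^ a * p ^ s)) (powerProducts-unique a s q-prime p-prime p≢q)
    (mk⇔ (λ d∈ → ∣⇒∈-powerProducts a s q-prime p-prime (∈-divisors⁻ d∈))
         (λ d∈ → ∈-divisors⁺ (∈-powerProducts⇒∣ q a p s d∈))))
  where
  instance
    _ = m*n≢0 (q ^ a) (p ^ s) {{m^n≢0 q a {{prime⇒nonZero q-prime}}}} {{m^n≢0 p s {{prime⇒nonZero p-prime}}}}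

σ-powerProduct : ∀ {q p} k a s → Prime q → Prime p → p ≢ q →
  σ k (q ^ a * p ^ s) ≡ powerSum (q ^ k) a * powerSum (p ^ k) s
σ-powerProduct k a s q-prime p-prime p≢q =
  trans (sum-↭ (↭.map⁺ (_^ k) (divisors↭powerProducts a s q-prime p-prime p≢q)))
        (sum-^-powerProducts k _ a _ s)

∣σ₅⇒∣powerSums : ∀ a {p} → Prime p → p ≢ 2 → 2 ^ a * p ^ 3 ∣ σ 5 (2 ^ a * p ^ 3) →
  2 ^ a ∣ powerSum (p ^ 5) 3 × p ^ 3 ∣ powerSum 32 a
∣σ₅⇒∣powerSums a {p} p-prime p≢2 n∣σ =
  prime^∣m*n⇒∣m a Q prime[2] (∤powerSum a (λ ()) (divides 16 refl))
    (subst (2 ^ a ∣_) (*-comm G Q) (m*n∣⇒m∣ (2 ^ a) (p ^ 3) n∣GQ)) ,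
  prime^∣m*n⇒∣m 3 G p-prime (∤powerSum 3 (prime≢1 p-prime) (m∣m*n (p ^ 4)))
    (m*n∣⇒n∣ (2 ^ a) (p ^ 3) n∣GQ)
  where
  G Q : ℕ
  G = powerSum 32 a
  Q = powerSum (p ^ 5) 3
  n∣GQ : 2 ^ a * p ^ 3 ∣ G * Q
  n∣GQ = subst (2 ^ a * p ^ 3 ∣_) (σ-powerProduct 5 a 3 prime[2] p-prime p≢2) n∣σ

1+p⁵≡[1+p]*odd : ∀ {p} j → p ≡ 1 + 2 * j → 1 + p ^ 5 ≡ (1 + p) * (1 + 2 * (j * (p ^ 3 + p)))
1+p⁵≡[1+p]*odd j refl = solve 1 (λ j →
  con 1 :+ (con 1 :+ con 2 :* j) :^ 5
    := (con 1 :+ (con 1 :+ con 2 :* j))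
       :* (con 1 :+ con 2 :* (j :* ((con 1 :+ con 2 :* j) :^ 3 :+ (con 1 :+ con 2 :* j)))))
  refl j

p²≡1+4[j+j²] : ∀ {p} j → p ≡ 1 + 2 * j → p ^ 2 ≡ 1 + 4 * (j + j * j)
p²≡1+4[j+j²] j refl = solve 1 (λ j → (con 1 :+ con 2 :* j) :^ 2 := con 1 :+ con 4 :* (j :+ j :* j)) refl j

1+p¹⁰≡2*odd : ∀ {p} t → p ^ 2 ≡ 1 + 4 * t → ∃ λ w → 1 + p ^ 10 ≡ 2 * (1 + 2 * w)
1+p¹⁰≡2*odd {p} t p²≡ =
  let w , eq = [1+m*t]^n≡1+m*w 4 t 5 in
  w , (begin
    1 + p ^ 10          ≡⟨ cong (1 +_) (^-*-assoc p 2 5) ⟨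
    1 + (p ^ 2) ^ 5     ≡⟨ cong (λ z → 1 + z ^ 5) p²≡ ⟩
    1 + (1 + 4 * t) ^ 5 ≡⟨ cong (1 +_) eq ⟩
    1 + (1 + 4 * w)     ≡⟨ halve w ⟩
    2 * (1 + 2 * w)     ∎)
  where
  open ≡-Reasoning
  halve : ∀ w → 1 + (1 + 4 * w) ≡ 2 * (1 + 2 * w)
  halve = solve-∀

powerSum-odd⁵-3 : ∀ {p} j → p ≡ 1 + 2 * j → ∃₂ λ u v →
  powerSum (p ^ 5) 3 ≡ 2 * ((1 + p) * (1 + 2 * u) * (1 + 2 * v))
powerSum-odd⁵-3 {p} j p≡ =
  let v , 1+p¹⁰≡ = 1+p¹⁰≡2*odd {p} (j + j * j) (p²≡1+4[j+j²] j p≡) in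
  u , v , (begin
    powerSum (p ^ 5) 3
  ≡⟨ geometric3 (p ^ 5) ⟩
    (1 + p ^ 5) * (1 + p ^ 5 * p ^ 5)
  ≡⟨ cong₂ (λ x y → x * (1 + y)) (1+p⁵≡[1+p]*odd j p≡) (sym (^-distribˡ-+-* p 5 5)) ⟩
    (1 + p) * (1 + 2 * u) * (1 + p ^ 10)
  ≡⟨ cong ((1 + p) * (1 + 2 * u) *_) 1+p¹⁰≡ ⟩
    (1 + p) * (1 + 2 * u) * (2 * (1 + 2 * v))
  ≡⟨ x∙yz≈y∙xz ((1 + p) * (1 + 2 * u)) 2 (1 + 2 * v) ⟩
    2 * ((1 + p) * (1 + 2 * u) * (1 + 2 * v)) ∎)
  where
  open ≡-Reasoning
  u : ℕ
  u = j * (p ^ 3 + p)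
  geometric3 : ∀ y → 1 + y * (1 + y * (1 + y * 1)) ≡ (1 + y) * (1 + y * y)
  geometric3 = solve-∀

2^[1+b]∣Q⇒2^b∣1+p : ∀ {p} j b → p ≡ 1 + 2 * j → 2 ^ suc b ∣ powerSum (p ^ 5) 3 → 2 ^ b ∣ 1 + p
2^[1+b]∣Q⇒2^b∣1+p {p} j b p≡ 2^a∣Q =
  let u , v , Q≡ = powerSum-odd⁵-3 j p≡ in
  prime^∣m*n⇒∣m b (1 + p) prime[2] (odd u)
    (prime^∣m*n⇒∣m b ((1 + p) * (1 + 2 * u)) prime[2] (odd v)
      (*-cancelˡ-∣ 2 (subst (2 ^ suc b ∣_) Q≡ 2^a∣Q)))
  where
  odd : ∀ w → 2 ∤ 1 + 2 * w
  odd w = ∣m⇒∤1+m*n 2 w (λ ()) ∣-refl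

k⁵[31G+1]≡1024[k2ᵇ]⁵ : ∀ k b → k ^ 5 * (31 * powerSum 32 (suc b) + 1) ≡ 1024 * (k * 2 ^ b) ^ 5
k⁵[31G+1]≡1024[k2ᵇ]⁵ k b = begin
    k ^ 5 * (31 * powerSum 32 (suc b) + 1)
  ≡⟨ cong (k ^ 5 *_) (powerSum-geometric 31 (suc b)) ⟩
    k ^ 5 * (32 * (32 * 32 ^ b))
  ≡⟨ cong (k ^ 5 *_) (*-assoc 32 32 (32 ^ b)) ⟨
    k ^ 5 * (1024 * (2 ^ 5) ^ b)
  ≡⟨ cong (λ z → k ^ 5 * (1024 * z)) 32^b≡[2^b]⁵ ⟩
    k ^ 5 * (1024 * (2 ^ b) ^ 5)
  ≡⟨ x∙yz≈y∙xz (k ^ 5) 1024 ((2 ^ b) ^ 5) ⟩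
    1024 * (k ^ 5 * (2 ^ b) ^ 5)
  ≡⟨ cong (1024 *_) (^-distribʳ-* k (2 ^ b) 5) ⟨
    1024 * (k * 2 ^ b) ^ 5 ∎
  where
  open ≡-Reasoning
  32^b≡[2^b]⁵ : (2 ^ 5) ^ b ≡ (2 ^ b) ^ 5
  32^b≡[2^b]⁵ = trans (^-*-assoc 2 5 b) (trans (cong (2 ^_) (*-comm 5 b)) (sym (^-*-assoc 2 b 5)))

[1+p]⁵≡1+p*[5+p*D] : ∀ p → (1 + p) ^ 5 ≡ 1 + p * (5 + p * (10 + p * (10 + p * (5 + p))))
[1+p]⁵≡1+p*[5+p*D] = solve 1 (λ p →
  (con 1 :+ p) :^ 5 := con 1 :+ p :* (con 5 :+ p :* (con 10 :+ p :* (con 10 :+ p :* (con 5 :+ p))))) refl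

p∣G⇒p∣∣k⁵-1024∣ : ∀ {p G} k → p ∣ G → k ^ 5 * (31 * G + 1) ≡ 1024 * (1 + p) ^ 5 →
  p ∣ ∣ k ^ 5 - 1024 ∣
p∣G⇒p∣∣k⁵-1024∣ {p} k (divides g refl) eq =
  m+d*x≡n+d*y⇒d∣∣m-n∣ (k ^ 5) 1024 (k ^ 5 * 31 * g) (1024 * C) (begin
    k ^ 5 + p * (k ^ 5 * 31 * g) ≡⟨ spread (k ^ 5) g p ⟩
    k ^ 5 * (31 * (g * p) + 1)   ≡⟨ eq ⟩
    1024 * (1 + p) ^ 5           ≡⟨ cong (1024 *_) ([1+p]⁵≡1+p*[5+p*D] p) ⟩
    1024 * (1 + p * C)           ≡⟨ *-distribˡ-+ 1024 1 (p * C) ⟩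
    1024 * 1 + 1024 * (p * C)    ≡⟨ cong₂ _+_ (*-identityʳ 1024) (x∙yz≈y∙xz 1024 p C) ⟩
    1024 + p * (1024 * C)        ∎)
  where
  open ≡-Reasoning
  C : ℕ
  C = 5 + p * (10 + p * (10 + p * (5 + p)))
  spread : ∀ K g p → K + p * (K * 31 * g) ≡ K * (31 * (g * p) + 1)
  spread = solve-∀

p³∣G⇒p∣5 : ∀ {p G} .{{_ : NonZero p}} → p ^ 3 ∣ G → 31 * G + 1 ≡ (1 + p) ^ 5 → p ∣ 5
p³∣G⇒p∣5 {p} (divides g refl) eq =
  m+d*x≡n+d*y⇒d∣∣m-n∣ 0 5 (31 * g * p) D
    (*-cancelˡ-≡ _ _ p (+-cancelʳ-≡ 1 _ _
      (trans (lhs g p) (trans eq (trans ([1+p]⁵≡1+p*[5+p*D] p) (+-comm 1 _))))))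
  where
  D : ℕ
  D = 10 + p * (10 + p * (5 + p))
  lhs : ∀ g p → p * (p * (31 * g * p)) + 1 ≡ 31 * (g * p ^ 3) + 1
  lhs = solve 2 (λ g p → p :* (p :* (con 31 :* g :* p)) :+ con 1 := con 31 :* (g :* p :^ 3) :+ con 1) refl

Counterexample : ℕ → ℕ → ℕ → Set
Counterexample p k b = p % 4 ≡ 3 × p ∣ ∣ k ^ 5 - 1024 ∣ × p ^ 3 ∣ powerSum 32 (suc b)

counterexample? : ∀ p k b → Dec (Counterexample p k b)
counterexample? p k b = p % 4 ≟ 3 ×-dec p ∣? ∣ k ^ 5 - 1024 ∣ ×-dec p ^ 3 ∣? powerSum 32 (suc b)

candidates : List ℕ
candidates = 1 ∷ 2 ∷ 3 ∷ 5 ∷ []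

candidate-bounds : All (λ k → 0 < ∣ k ^ 5 - 1024 ∣ × ∣ k ^ 5 - 1024 ∣ < 2102) candidates
candidate-bounds =
  from-yes (All.all? (λ k → 0 <? ∣ k ^ 5 - 1024 ∣ ×-dec ∣ k ^ 5 - 1024 ∣ <? 2102) candidates)

no-counterexample : All (λ k → All (λ b → ¬ Counterexample (pred (k * 2 ^ b)) k b) (upTo 12)) candidates
no-counterexample = from-yes (All.all? (λ k → All.all? (λ b →
  ¬? (counterexample? (pred (k * 2 ^ b)) k b)) (upTo 12)) candidates)

p∣c<2102⇒b<12 : ∀ {b p c} .{{_ : NonZero c}} → c < 2102 → 2 ^ b ∣ 1 + p → p ∣ c → b < 12
p∣c<2102⇒b<12 {b} {p} {c} c<2102 2ᵇ∣1+p p∣c =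
  ≰⇒> λ 12≤b → <⇒≱ (from-yes (2102 <? 4096)) (begin
    2 ^ 12    ≤⟨ ^-monoʳ-≤ 2 12≤b ⟩
    2 ^ b     ≤⟨ ∣⇒≤ 2ᵇ∣1+p ⟩
    1 + p     ≤⟨ s≤s (∣⇒≤ p∣c) ⟩
    1 + c     ≤⟨ c<2102 ⟩
    2102      ∎)
  where open ≤-Reasoning

candidate-impossible : ∀ {k} b {p} → k ∈ candidates → k * 2 ^ b ≡ 1 + p → p % 4 ≡ 3 →
  p ^ 3 ∣ powerSum 32 (suc b) → ⊥
candidate-impossible {k} b {p} k∈ eq p%4≡3 p³∣G with All.lookup candidate-bounds k∈
... | 0<c , c<2102 = All.lookup (All.lookup no-counterexample k∈) (∈-upTo⁺ b<12)
  (subst (λ x → Counterexample x k b) (cong pred (sym eq)) (p%4≡3 , p∣c , p³∣G))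
  where
  instance _ = >-nonZero 0<c
  p∣c : p ∣ ∣ k ^ 5 - 1024 ∣
  p∣c = p∣G⇒p∣∣k⁵-1024∣ k (∣-trans (m∣m*n (p ^ 2)) p³∣G)
    (trans (k⁵[31G+1]≡1024[k2ᵇ]⁵ k b) (cong (λ x → 1024 * x ^ 5) eq))
  b<12 : b < 12
  b<12 = p∣c<2102⇒b<12 c<2102 (divides k (sym eq)) p∣c

four-impossible : ∀ b {p} .{{_ : NonZero p}} → 4 * 2 ^ b ≡ 1 + p → p % 4 ≡ 3 →
  p ^ 3 ∣ powerSum 32 (suc b) → ⊥
four-impossible b {p} eq p%4≡3 p³∣G = 3mod4∤5 p%4≡3 (p³∣G⇒p∣5 {p} {powerSum 32 (suc b)} p³∣G
  (*-cancelˡ-≡ _ _ 1024 (trans (k⁵[31G+1]≡1024[k2ᵇ]⁵ 4 b) (cong (λ x → 1024 * x ^ 5) eq))))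

k<6-impossible : ∀ k b {p} .{{_ : NonZero p}} → k < 6 → k * 2 ^ b ≡ 1 + p → p % 4 ≡ 3 →
  p ^ 3 ∣ powerSum 32 (suc b) → ⊥
k<6-impossible 0 _ _ ()
k<6-impossible 1 b _ = candidate-impossible b (here refl)
k<6-impossible 2 b _ = candidate-impossible b (there (here refl))
k<6-impossible 3 b _ = candidate-impossible b (there (there (here refl)))
k<6-impossible 4 b _ = four-impossible b
k<6-impossible 5 b _ = candidate-impossible b (there (there (there (here refl))))
k<6-impossible (suc (suc (suc (suc (suc (suc _)))))) _ (s≤s (s≤s (s≤s (s≤s (s≤s (s≤s ()))))))

lemma4p1 : (α p : ℕ) → 1 < α → Prime p → p % 4 ≡ 3
    → p < 3 * 2 ^ (α ∸ 1) ∸ 1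
    → ¬ ((2 ^ (α ∸ 1) * p ^ 3) ∣ σ 5 (2 ^ (α ∸ 1) * p ^ 3))
lemma4p1 1 _ (s≤s ())
lemma4p1 (suc (suc b)) p _ p-prime p%4≡3 p<bound n∣σ =
  k<6-impossible k b k<6 (sym (m∣n⇒n≡quotient*m 2ᵇ∣1+p)) p%4≡3 (proj₂ n∣σ⇒)
  where
  instance _ = prime⇒nonZero p-prime
  p≢2 : p ≢ 2
  p≢2 p≡2 = contradiction (trans (sym p%4≡3) (cong (_% 4) p≡2)) λ ()
  n∣σ⇒ : 2 ^ suc b ∣ powerSum (p ^ 5) 3 × p ^ 3 ∣ powerSum 32 (suc b)
  n∣σ⇒ = ∣σ₅⇒∣powerSums (suc b) p-prime p≢2 n∣σ
  2ᵇ∣1+p : 2 ^ b ∣ 1 + p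
  2ᵇ∣1+p = 2^[1+b]∣Q⇒2^b∣1+p (1 + 2 * (p / 4)) b (3mod4⇒odd p p%4≡3) (proj₁ n∣σ⇒)
  k : ℕ
  k = quotient 2ᵇ∣1+p
  k<6 : k < 6
  k<6 = *-cancelʳ-< (2 ^ b) k 6 (begin-strict
    k * 2 ^ b         ≡⟨ m∣n⇒n≡quotient*m 2ᵇ∣1+p ⟨
    1 + p             <⟨ m<n∸1⇒1+m<n _ p<bound ⟩
    3 * (2 * 2 ^ b)   ≡⟨ *-assoc 3 2 (2 ^ b) ⟨
    6 * 2 ^ b         ∎)
    where open ≤-Reasoning
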